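{- Let $G$ be a transitive permutation group on $\{a_1,\dots,a_m\}$ and $H$ a primitive permutation group on $\{b_1,\dots,b_n\}$. Then the wreath product $G[H]$ has the average fixed point lifting property, unless $\#G[H]=\#G$.
   Context: The wreath product $G[H]$ consists of elements $\sigma=(g;h_1,\dots,h_m)$ with $g\in G$, $h_i\in H$, acting on $\{a_1,\dots,a_m\}\times\{b_1,\dots,b_n\}$ by $\sigma(a_i,b_j)=(g(a_i),h_i(b_j))$, with the induced group law; $\pi:G[H]\to G$ is the restriction map $(g;h_1,\dots,h_m)\mapsto g$. $G[H]$ has the average fixed point lifting property if for every $g\in G$, $\#\mathrm{Fix}(g)=\frac{1}{\#\pi^{ -1}(g)}\sum_{\pi(g')=g}\#\mathrm{Fix}(g')$, where $\mathrm{Fix}(g)$ is the set of fixed points of $g$ in $\{a_1,\dots,a_m\}$ and $\mathrm{Fix}(g')$ the set of fixed points of $g'$ in $\{a_1,\dots,a_m\}\times\{b_1,\dots,b_n\}$. A transitive permutation group is primitive if it preserves no non-trivial partition of the set it acts on. -}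

module Defs where

open import Data.Nat using (ℕ; zero; suc; _*_)
open import Data.Fin using (Fin; _≟_)
open import Data.Vec using (Vec; []; _∷_; lookup; tabulate)
open import Data.Vec.Properties using (≡-dec)
open import Data.List using (List; []; _∷_; [_]; map; concatMap; filter; length; cartesianProduct; allFin)
open import Data.Nat.ListAction using (sum)
open import Data.List.Membership.Propositional using (_∈_)
open import Data.List.Relation.Unary.Unique.Propositional using (Unique)
open import Data.Product using (Σ; ∃; ∃-syntax; _×_; _,_; proj₁; proj₂)
open import Relation.Binary.PropositionalEquality using (_≡_; _≢_)
open import Relation.Nullary using (¬_)
open import Relation.Nullary.Decidable using (_×-dec_)
open import Function using (id)

-- A permutation of Fin m is represented by its table: σ(i) = lookup σ i.
Perm : ℕ → Set
Perm m = Vec (Fin m) m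

idPerm : ∀ {m} → Perm m
idPerm = tabulate id

_∘ₚ_ : ∀ {m} → Perm m → Perm m → Perm m
u ∘ₚ v = tabulate (λ i → lookup u (lookup v i))

-- A permutation group on Fin m: a finite list of distinct tables that
-- contains the identity and is closed under composition and inverses
-- (every element has a two-sided inverse in the list, so every element
-- is a genuine permutation).
record PermGroup (m : ℕ) : Set where
  field
    els    : List (Perm m)
    unique : Unique els
    id∈    : idPerm ∈ els
    comp∈  : ∀ {u v} → u ∈ els → v ∈ els → (u ∘ₚ v) ∈ els
    inv∈   : ∀ {u} → u ∈ els →
             Σ (Perm m) (λ w → w ∈ els × (u ∘ₚ w ≡ idPerm) × (w ∘ₚ u ≡ idPerm))
open PermGroup public

#_ : ∀ {m} → PermGroup m → ℕ
# G = length (els G)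

Transitive : ∀ {m} → PermGroup m → Set
Transitive {m} G = ∀ (a b : Fin m) → Σ (Perm m) (λ g → g ∈ els G × lookup g a ≡ b)

-- A partition of Fin n is given by a class-labelling f : Fin n → ℕ
-- (x, y in the same block iff f x ≡ f y).
Preserves : ∀ {n} → PermGroup n → (Fin n → ℕ) → Set
Preserves {n} H f = ∀ {h} → h ∈ els H → ∀ (x y : Fin n) →
  f x ≡ f y → f (lookup h x) ≡ f (lookup h y)

NonTrivialPartition : ∀ {n} → (Fin n → ℕ) → Set
NonTrivialPartition {n} f =
  (Σ (Fin n) λ x → Σ (Fin n) λ y → x ≢ y × f x ≡ f y) ×
  (Σ (Fin n) λ x → Σ (Fin n) λ y → f x ≢ f y)

Primitive : ∀ {n} → PermGroup n → Set
Primitive {n} H = Transitive H × (∀ (f : Fin n → ℕ) → Preserves H f → ¬ NonTrivialPartition f)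

allVecs : ∀ {A : Set} (k : ℕ) → List A → List (Vec A k)
allVecs zero    xs = [ [] ]
allVecs (suc k) xs = concatMap (λ x → map (x ∷_) (allVecs k xs)) xs

-- elements of the wreath product G[H]: (g; h_1,…,h_m), with h_i = lookup hs i
WElem : ℕ → ℕ → Set
WElem m n = Perm m × Vec (Perm n) m

wreathEls : ∀ {m n} → PermGroup m → PermGroup n → List (WElem m n)
wreathEls {m} G H = cartesianProduct (els G) (allVecs m (els H))

#wreath : ∀ {m n} → PermGroup m → PermGroup n → ℕ
#wreath G H = length (wreathEls G H)

π : ∀ {m n} → WElem m n → Perm m
π = proj₁

fiber : ∀ {m n} → PermGroup m → PermGroup n → Perm m → List (WElem m n)
fiber {m} G H g = filter (λ σ → ≡-dec _≟_ (π σ) g) (wreathEls G H)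

#Fix : ∀ {m} → Perm m → ℕ
#Fix {m} g = length (filter (λ a → lookup g a ≟ a) (allFin m))

-- σ(a,b) = (g a, h_a b); #Fix(σ) on {a_i} × {b_j}
#FixW : ∀ {m n} → WElem m n → ℕ
#FixW {m} {n} (g , hs) =
  length (filter (λ p → (lookup g (proj₁ p) ≟ proj₁ p)
                        ×-dec (lookup (lookup hs (proj₁ p)) (proj₂ p) ≟ proj₂ p))
                 (cartesianProduct (allFin m) (allFin n)))

-- Average fixed point lifting property, with the denominator #π⁻¹(g)
-- cleared (it is positive):  #Fix(g) · #π⁻¹(g) = Σ_{π(g')=g} #Fix(g').
AFPLP : ∀ {m n} → PermGroup m → PermGroup n → Set
AFPLP G H = ∀ {g} → g ∈ els G →
  #Fix g * length (fiber G H g) ≡ sum (map #FixW (fiber G H g))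

{-# OPTIONS --safe #-}
module Submission where

-- For g in G, the fibre of π over g is {g} × H^m, and σ = (g; h_1, …, h_m) fixes (a, b)
-- iff g fixes a and h_a fixes b; hence #Fix σ = Σ_{a ∈ Fix g} #Fix h_a.  As σ runs over
-- the fibre each coordinate h_a runs uniformly over H, so the average of #Fix σ is #Fix g
-- times the average number of fixed points of H.  For transitive H on a non-empty set the
-- latter is 1 by orbit counting (#H = n · #Stab b for every point b).  If H acts on the
-- empty set then H is trivial and #G[H] = #G.

open import Defs
open import Algebra.Properties.CommutativeSemigroup using (interchange; x∙yz≈y∙xz)
open import Data.Empty using (⊥-elim)
open import Data.Fin using (Fin; zero; suc; _≟_)
open import Data.List using (List; []; _∷_; [_]; _++_; map; concatMap; filter; length; cartesianProduct; allFin)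
open import Data.List.Membership.Propositional using (_∈_)
open import Data.List.Membership.Propositional.Properties using (∈-map⁺; ∈-map⁻; ∈-allFin)
open import Data.List.Membership.Propositional.Properties.WithK using (unique∧set⇒bag)
open import Data.List.Properties using (map-++; map-cong; map-∘; ++-identityʳ; length-map; length-tabulate; filter-++; filter-all; filter-none; filter-accept; filter-reject)
open import Data.List.Relation.Binary.BagAndSetEquality using (∼bag⇒↭)
open import Data.List.Relation.Binary.Permutation.Propositional using (_↭_)
import Data.List.Relation.Binary.Permutation.Propositional.Properties as ↭
open import Data.List.Relation.Unary.All as All using (_∷_)
import Data.List.Relation.Unary.All.Properties as Allₚ
open import Data.List.Relation.Unary.Any using (here; there)
open import Data.List.Relation.Unary.AllPairs using (_∷_)
open import Data.List.Relation.Unary.Unique.Propositional using (Unique)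
import Data.List.Relation.Unary.Unique.Propositional.Properties as Unique
open import Data.Nat using (ℕ; zero; suc; _+_; _*_; _^_)
open import Data.Nat.ListAction using (sum)
open import Data.Nat.ListAction.Properties using (sum-++; sum-↭)
open import Data.Nat.Properties using (*-comm; *-zeroʳ; *-identityˡ; *-identityʳ; *-distribˡ-+; *-cancelˡ-≡; ^-zeroˡ; +-commutativeSemigroup; *-commutativeSemigroup)
open import Data.Product using (_×_; _,_; proj₁)
open import Data.Sum using (_⊎_; inj₁; inj₂)
open import Data.Vec using (Vec; []; _∷_; lookup)
open import Data.Vec.Properties using (≡-dec; lookup∘tabulate; tabulate∘lookup; tabulate-cong)
open import Function using (id; _∘_; _⇔_; mk⇔; Equivalence)
open import Relation.Binary.Definitions using (DecidableEquality)
open import Relation.Binary.PropositionalEquality using (_≡_; refl; sym; trans; cong; cong₂; subst; module ≡-Reasoning)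
open import Relation.Nullary using (Dec; yes; no; Irrelevant)
open import Relation.Nullary.Decidable using (_×-dec_)
open import Relation.Unary using (Decidable)

open ≡-Reasoning

private
  variable
    A B : Set
    m n : ℕ

∑ : List A → (A → ℕ) → ℕ
∑ xs f = sum (map f xs)

syntax ∑ xs (λ x → e) = ∑[ x ∈ xs ] e

∑-cong : (xs : List A) {f g : A → ℕ} → (∀ x → f x ≡ g x) → ∑ xs f ≡ ∑ xs g
∑-cong xs f≗g = cong sum (map-cong f≗g xs)

∑-++ : (xs ys : List A) (f : A → ℕ) → ∑ (xs ++ ys) f ≡ ∑ xs f + ∑ ys f
∑-++ xs ys f = trans (cong sum (map-++ f xs ys)) (sum-++ (map f xs) (map f ys))

∑-map : (g : A → B) (xs : List A) (f : B → ℕ) → ∑ (map g xs) f ≡ ∑ xs (f ∘ g)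
∑-map g xs f = cong sum (sym (map-∘ xs))

∑-↭ : {xs ys : List A} (f : A → ℕ) → xs ↭ ys → ∑ xs f ≡ ∑ ys f
∑-↭ f xs↭ys = sum-↭ (↭.map⁺ f xs↭ys)

∑-+ : (xs : List A) (f g : A → ℕ) → ∑[ x ∈ xs ] (f x + g x) ≡ ∑ xs f + ∑ xs g
∑-+ []       f g = refl
∑-+ (x ∷ xs) f g = trans (cong (f x + g x +_) (∑-+ xs f g))
                         (interchange +-commutativeSemigroup (f x) (g x) (∑ xs f) (∑ xs g))

∑-*ˡ : (xs : List A) (c : ℕ) (f : A → ℕ) → ∑[ x ∈ xs ] (c * f x) ≡ c * ∑ xs f
∑-*ˡ []       c f = sym (*-zeroʳ c)
∑-*ˡ (x ∷ xs) c f = trans (cong (c * f x +_) (∑-*ˡ xs c f)) (sym (*-distribˡ-+ c (f x) (∑ xs f)))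

∑-*ʳ : (xs : List A) (f : A → ℕ) (c : ℕ) → ∑[ x ∈ xs ] (f x * c) ≡ ∑ xs f * c
∑-*ʳ xs f c = begin
  ∑[ x ∈ xs ] (f x * c)  ≡⟨ ∑-cong xs (λ x → *-comm (f x) c) ⟩
  ∑[ x ∈ xs ] (c * f x)  ≡⟨ ∑-*ˡ xs c f ⟩
  c * ∑ xs f             ≡⟨ *-comm c (∑ xs f) ⟩
  ∑ xs f * c             ∎

∑-const : (xs : List A) (c : ℕ) → ∑ xs (λ _ → c) ≡ length xs * c
∑-const []       c = refl
∑-const (x ∷ xs) c = cong (c +_) (∑-const xs c)

length≡∑1 : (xs : List A) → length xs ≡ ∑ xs (λ _ → 1)
length≡∑1 xs = sym (trans (∑-const xs 1) (*-identityʳ (length xs)))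

∑-concatMap : (g : A → List B) (xs : List A) (f : B → ℕ) →
  ∑ (concatMap g xs) f ≡ ∑[ x ∈ xs ] ∑ (g x) f
∑-concatMap g []       f = refl
∑-concatMap g (x ∷ xs) f =
  trans (∑-++ (g x) (concatMap g xs) f) (cong (∑ (g x) f +_) (∑-concatMap g xs f))

∑-cartesianProduct : (xs : List A) (ys : List B) (f : A × B → ℕ) →
  ∑ (cartesianProduct xs ys) f ≡ ∑[ x ∈ xs ] ∑[ y ∈ ys ] f (x , y)
∑-cartesianProduct []       ys f = refl
∑-cartesianProduct (x ∷ xs) ys f =
  trans (∑-++ (map (x ,_) ys) (cartesianProduct xs ys) f)
        (cong₂ _+_ (∑-map (x ,_) ys f) (∑-cartesianProduct xs ys f))

∑-comm : (xs : List A) (ys : List B) (f : A → B → ℕ) →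
  ∑[ x ∈ xs ] ∑[ y ∈ ys ] f x y ≡ ∑[ y ∈ ys ] ∑[ x ∈ xs ] f x y
∑-comm []       ys f = sym (trans (∑-const ys 0) (*-zeroʳ (length ys)))
∑-comm (x ∷ xs) ys f = trans (cong (∑ ys (f x) +_) (∑-comm xs ys f)) (sym (∑-+ ys (f x) _))

length-cartesianProduct : (xs : List A) (ys : List B) →
  length (cartesianProduct xs ys) ≡ length xs * length ys
length-cartesianProduct xs ys = begin
  length (cartesianProduct xs ys)       ≡⟨ length≡∑1 (cartesianProduct xs ys) ⟩
  ∑ (cartesianProduct xs ys) (λ _ → 1)  ≡⟨ ∑-cartesianProduct xs ys _ ⟩
  ∑[ x ∈ xs ] ∑ ys (λ _ → 1)            ≡⟨ ∑-cong xs (λ _ → sym (length≡∑1 ys)) ⟩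
  ∑ xs (λ _ → length ys)                ≡⟨ ∑-const xs _ ⟩
  length xs * length ys                 ∎

𝟙 : {P : Set} → Dec P → ℕ
𝟙 (yes _) = 1
𝟙 (no _)  = 0

𝟙-⇔ : {P Q : Set} (P? : Dec P) (Q? : Dec Q) → P ⇔ Q → 𝟙 P? ≡ 𝟙 Q?
𝟙-⇔ (yes _) (yes _) _   = refl
𝟙-⇔ (yes p) (no ¬q) P⇔Q = ⊥-elim (¬q (Equivalence.to P⇔Q p))
𝟙-⇔ (no ¬p) (yes q) P⇔Q = ⊥-elim (¬p (Equivalence.from P⇔Q q))
𝟙-⇔ (no _)  (no _)  _   = refl

𝟙-×-dec : {P Q : Set} (P? : Dec P) (Q? : Dec Q) → 𝟙 (P? ×-dec Q?) ≡ 𝟙 P? * 𝟙 Q?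
𝟙-×-dec (yes _) (yes _) = refl
𝟙-×-dec (yes _) (no _)  = refl
𝟙-×-dec (no _)  _       = refl

length-filter≡∑𝟙 : {P : A → Set} (P? : Decidable P) (xs : List A) →
  length (filter P? xs) ≡ ∑[ x ∈ xs ] 𝟙 (P? x)
length-filter≡∑𝟙 P? []       = refl
length-filter≡∑𝟙 P? (x ∷ xs) with P? x
... | yes _ = cong suc (length-filter≡∑𝟙 P? xs)
... | no _  = length-filter≡∑𝟙 P? xs

filter-≟-Unique : (_≟ᴬ_ : DecidableEquality A) {x : A} {xs : List A} →
  Unique xs → x ∈ xs → filter (_≟ᴬ x) xs ≡ [ x ]
filter-≟-Unique _≟ᴬ_ (x≢xs ∷ _) (here refl) =
  trans (filter-accept (_≟ᴬ _) refl)
        (cong (_ ∷_) (filter-none (_≟ᴬ _) (All.map (λ x≢y y≡x → x≢y (sym y≡x)) x≢xs)))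
filter-≟-Unique _≟ᴬ_ (y≢xs ∷ xs-unique) (there x∈xs) =
  trans (filter-reject (_≟ᴬ _) (All.lookup y≢xs x∈xs)) (filter-≟-Unique _≟ᴬ_ xs-unique x∈xs)

∑-𝟙-≟ : (_≟ᴬ_ : DecidableEquality A) {x : A} {xs : List A} →
  Unique xs → x ∈ xs → ∑[ y ∈ xs ] 𝟙 (x ≟ᴬ y) ≡ 1
∑-𝟙-≟ _≟ᴬ_ {x} {xs} xs-unique x∈xs = begin
  ∑[ y ∈ xs ] 𝟙 (x ≟ᴬ y)      ≡⟨ ∑-cong xs (λ y → 𝟙-⇔ (x ≟ᴬ y) (y ≟ᴬ x) (mk⇔ sym sym)) ⟩
  ∑[ y ∈ xs ] 𝟙 (y ≟ᴬ x)      ≡⟨ length-filter≡∑𝟙 (_≟ᴬ x) xs ⟨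
  length (filter (_≟ᴬ x) xs)  ≡⟨ cong length (filter-≟-Unique _≟ᴬ_ xs-unique x∈xs) ⟩
  1                           ∎

filter-proj₁-cartesianProduct : {P : A → Set} (P? : Decidable P) (xs : List A) (ys : List B) →
  filter (P? ∘ proj₁) (cartesianProduct xs ys) ≡ cartesianProduct (filter P? xs) ys
filter-proj₁-cartesianProduct P? []       ys = refl
filter-proj₁-cartesianProduct P? (x ∷ xs) ys with P? x
... | yes px = trans (filter-++ (P? ∘ proj₁) (map (x ,_) ys) _)
                     (cong₂ _++_ (filter-all (P? ∘ proj₁) (Allₚ.map⁺ (All.universal (λ _ → px) ys)))
                                 (filter-proj₁-cartesianProduct P? xs ys))
... | no ¬px = trans (filter-++ (P? ∘ proj₁) (map (x ,_) ys) _)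
                     (cong₂ _++_ (filter-none (P? ∘ proj₁) (Allₚ.map⁺ (All.universal (λ _ → ¬px) ys)))
                                 (filter-proj₁-cartesianProduct P? xs ys))

length-Unique-Irrelevant : Irrelevant A → {x : A} {xs : List A} →
  Unique xs → x ∈ xs → length xs ≡ 1
length-Unique-Irrelevant irr {xs = _ ∷ []}    _                 _ = refl
length-Unique-Irrelevant irr {xs = y ∷ z ∷ _} ((y≢z ∷ _) ∷ _) _ = ⊥-elim (y≢z (irr y z))

∑-allVecs-suc : (k : ℕ) (xs : List A) (f : Vec A (suc k) → ℕ) →
  ∑ (allVecs (suc k) xs) f ≡ ∑[ x ∈ xs ] ∑[ v ∈ allVecs k xs ] f (x ∷ v)
∑-allVecs-suc k xs f =
  trans (∑-concatMap _ xs f) (∑-cong xs (λ x → ∑-map (x ∷_) (allVecs k xs) f))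

length-allVecs : (k : ℕ) (xs : List A) → length (allVecs k xs) ≡ length xs ^ k
length-allVecs zero    xs = refl
length-allVecs (suc k) xs = begin
  length (allVecs (suc k) xs)             ≡⟨ length≡∑1 (allVecs (suc k) xs) ⟩
  ∑ (allVecs (suc k) xs) (λ _ → 1)        ≡⟨ ∑-allVecs-suc k xs _ ⟩
  ∑[ x ∈ xs ] ∑ (allVecs k xs) (λ _ → 1)  ≡⟨ ∑-cong xs (λ _ → sym (length≡∑1 (allVecs k xs))) ⟩
  ∑ xs (λ _ → length (allVecs k xs))      ≡⟨ ∑-const xs _ ⟩
  length xs * length (allVecs k xs)       ≡⟨ cong (length xs *_) (length-allVecs k xs) ⟩
  length xs ^ suc k                       ∎

∑-allVecs-lookup : (k : ℕ) (xs : List A) (f : A → ℕ) (c : ℕ) → ∑ xs f ≡ c * length xs →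
  (a : Fin k) → ∑[ v ∈ allVecs k xs ] f (lookup v a) ≡ c * length xs ^ k
∑-allVecs-lookup (suc k) xs f c mean zero = begin
  ∑[ v ∈ allVecs (suc k) xs ] f (lookup v zero)
    ≡⟨ ∑-allVecs-suc k xs _ ⟩
  ∑[ x ∈ xs ] ∑ (allVecs k xs) (λ _ → f x)
    ≡⟨ ∑-cong xs (λ x → ∑-const (allVecs k xs) (f x)) ⟩
  ∑[ x ∈ xs ] (length (allVecs k xs) * f x)
    ≡⟨ ∑-*ˡ xs (length (allVecs k xs)) f ⟩
  length (allVecs k xs) * ∑ xs f
    ≡⟨ cong₂ _*_ (length-allVecs k xs) mean ⟩
  length xs ^ k * (c * length xs)
    ≡⟨ x∙yz≈y∙xz *-commutativeSemigroup (length xs ^ k) c (length xs) ⟩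
  c * (length xs ^ k * length xs)
    ≡⟨ cong (c *_) (*-comm (length xs ^ k) (length xs)) ⟩
  c * length xs ^ suc k
    ∎
∑-allVecs-lookup (suc k) xs f c mean (suc a) = begin
  ∑[ v ∈ allVecs (suc k) xs ] f (lookup v (suc a))
    ≡⟨ ∑-allVecs-suc k xs _ ⟩
  ∑[ x ∈ xs ] ∑[ v ∈ allVecs k xs ] f (lookup v a)
    ≡⟨ ∑-cong xs (λ _ → ∑-allVecs-lookup k xs f c mean a) ⟩
  ∑ xs (λ _ → c * length xs ^ k)
    ≡⟨ ∑-const xs _ ⟩
  length xs * (c * length xs ^ k)
    ≡⟨ x∙yz≈y∙xz *-commutativeSemigroup (length xs) c (length xs ^ k) ⟩
  c * length xs ^ suc k
    ∎

#Fix≡∑𝟙 : (g : Perm m) → #Fix g ≡ ∑[ a ∈ allFin m ] 𝟙 (lookup g a ≟ a)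
#Fix≡∑𝟙 {m} g = length-filter≡∑𝟙 (λ a → lookup g a ≟ a) (allFin m)

#FixW≡∑ : (g : Perm m) (hs : Vec (Perm n) m) →
  #FixW (g , hs) ≡ ∑[ a ∈ allFin m ] (𝟙 (lookup g a ≟ a) * #Fix (lookup hs a))
#FixW≡∑ {m} {n} g hs = begin
  #FixW (g , hs)
    ≡⟨ length-filter≡∑𝟙 _ (cartesianProduct (allFin m) (allFin n)) ⟩
  ∑ (cartesianProduct (allFin m) (allFin n)) _
    ≡⟨ ∑-cartesianProduct (allFin m) (allFin n) _ ⟩
  ∑[ a ∈ allFin m ] ∑[ b ∈ allFin n ] 𝟙 ((lookup g a ≟ a) ×-dec (lookup (lookup hs a) b ≟ b))
    ≡⟨ ∑-cong (allFin m) (λ a → ∑-cong (allFin n) (λ b → 𝟙-×-dec (lookup g a ≟ a) _)) ⟩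
  ∑[ a ∈ allFin m ] ∑[ b ∈ allFin n ] (fixes a * 𝟙 (lookup (lookup hs a) b ≟ b))
    ≡⟨ ∑-cong (allFin m) (λ a → ∑-*ˡ (allFin n) (fixes a) _) ⟩
  ∑[ a ∈ allFin m ] (fixes a * ∑[ b ∈ allFin n ] 𝟙 (lookup (lookup hs a) b ≟ b))
    ≡⟨ ∑-cong (allFin m) (λ a → cong (fixes a *_) (#Fix≡∑𝟙 (lookup hs a))) ⟨
  ∑[ a ∈ allFin m ] (fixes a * #Fix (lookup hs a))
    ∎
  where
  fixes : Fin m → ℕ
  fixes a = 𝟙 (lookup g a ≟ a)

∑-#FixW-fiber : (g : Perm m) (ps : List (Perm n)) (c : ℕ) → ∑ ps #Fix ≡ c * length ps →
  ∑[ hs ∈ allVecs m ps ] #FixW (g , hs) ≡ #Fix g * (c * length ps ^ m)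
∑-#FixW-fiber {m} g ps c mean = begin
  ∑[ hs ∈ allVecs m ps ] #FixW (g , hs)
    ≡⟨ ∑-cong (allVecs m ps) (#FixW≡∑ g) ⟩
  ∑[ hs ∈ allVecs m ps ] ∑[ a ∈ allFin m ] (fixes a * #Fix (lookup hs a))
    ≡⟨ ∑-comm (allVecs m ps) (allFin m) _ ⟩
  ∑[ a ∈ allFin m ] ∑[ hs ∈ allVecs m ps ] (fixes a * #Fix (lookup hs a))
    ≡⟨ ∑-cong (allFin m) (λ a → ∑-*ˡ (allVecs m ps) (fixes a) (λ hs → #Fix (lookup hs a))) ⟩
  ∑[ a ∈ allFin m ] (fixes a * ∑[ hs ∈ allVecs m ps ] #Fix (lookup hs a))
    ≡⟨ ∑-cong (allFin m) (λ a → cong (fixes a *_) (∑-allVecs-lookup m ps #Fix c mean a)) ⟩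
  ∑[ a ∈ allFin m ] (fixes a * (c * length ps ^ m))
    ≡⟨ ∑-*ʳ (allFin m) fixes (c * length ps ^ m) ⟩
  ∑ (allFin m) fixes * (c * length ps ^ m)
    ≡⟨ cong (_* (c * length ps ^ m)) (#Fix≡∑𝟙 g) ⟨
  #Fix g * (c * length ps ^ m)
    ∎
  where
  fixes : Fin m → ℕ
  fixes a = 𝟙 (lookup g a ≟ a)

fiber≡map : (G : PermGroup m) (H : PermGroup n) {g : Perm m} → g ∈ els G →
  fiber G H g ≡ map (g ,_) (allVecs m (els H))
fiber≡map {m} G H {g} g∈G = begin
  fiber G H g
    ≡⟨ filter-proj₁-cartesianProduct (_≟ᵥ g) (els G) V ⟩
  cartesianProduct (filter (_≟ᵥ g) (els G)) V
    ≡⟨ cong (λ gs → cartesianProduct gs V) (filter-≟-Unique _≟ᵥ_ (unique G) g∈G) ⟩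
  map (g ,_) V ++ []
    ≡⟨ ++-identityʳ _ ⟩
  map (g ,_) V
    ∎
  where
  _≟ᵥ_ = ≡-dec _≟_
  V = allVecs m (els H)

∑#Fix≡#⇒AFPLP : (G : PermGroup m) (H : PermGroup n) → ∑ (els H) #Fix ≡ # H → AFPLP G H
∑#Fix≡#⇒AFPLP {m} G H mean {g} g∈G = begin
  #Fix g * length (fiber G H g)
    ≡⟨ cong (λ σs → #Fix g * length σs) (fiber≡map G H g∈G) ⟩
  #Fix g * length (map (g ,_) V)
    ≡⟨ cong (#Fix g *_) (trans (length-map _ V) (length-allVecs m (els H))) ⟩
  #Fix g * # H ^ m
    ≡⟨ cong (#Fix g *_) (*-identityˡ _) ⟨
  #Fix g * (1 * # H ^ m)
    ≡⟨ ∑-#FixW-fiber g (els H) 1 (trans mean (sym (*-identityˡ _))) ⟨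
  ∑[ hs ∈ V ] #FixW (g , hs)
    ≡⟨ ∑-map (g ,_) V #FixW ⟨
  ∑ (map (g ,_) V) #FixW
    ≡⟨ cong (λ σs → ∑ σs #FixW) (fiber≡map G H g∈G) ⟨
  ∑ (fiber G H g) #FixW
    ∎
  where
  V = allVecs m (els H)

lookup-∘ₚ : (u v : Perm n) (i : Fin n) → lookup (u ∘ₚ v) i ≡ lookup u (lookup v i)
lookup-∘ₚ u v = lookup∘tabulate _

lookup-inverse : (w t : Perm n) → w ∘ₚ t ≡ idPerm → (x : Fin n) → lookup w (lookup t x) ≡ x
lookup-inverse w t wt≡id x = begin
  lookup w (lookup t x)  ≡⟨ lookup-∘ₚ w t x ⟨
  lookup (w ∘ₚ t) x      ≡⟨ cong (λ u → lookup u x) wt≡id ⟩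
  lookup idPerm x        ≡⟨ lookup∘tabulate _ x ⟩
  x                      ∎

lookup-injective : (w t : Perm n) → w ∘ₚ t ≡ idPerm →
  {x y : Fin n} → lookup t x ≡ lookup t y → x ≡ y
lookup-injective w t wt≡id {x} {y} tx≡ty = begin
  x                      ≡⟨ lookup-inverse w t wt≡id x ⟨
  lookup w (lookup t x)  ≡⟨ cong (lookup w) tx≡ty ⟩
  lookup w (lookup t y)  ≡⟨ lookup-inverse w t wt≡id y ⟩
  y                      ∎

∘ₚ-cancelˡ : (w t : Perm n) → w ∘ₚ t ≡ idPerm → (u : Perm n) → w ∘ₚ (t ∘ₚ u) ≡ u
∘ₚ-cancelˡ w t wt≡id u = trans (tabulate-cong wtu≗u) (tabulate∘lookup u)
  where
  wtu≗u : ∀ i → lookup w (lookup (t ∘ₚ u) i) ≡ lookup u i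
  wtu≗u i = trans (cong (lookup w) (lookup-∘ₚ t u i)) (lookup-inverse w t wt≡id (lookup u i))

translate-↭ : (H : PermGroup n) {t : Perm n} → t ∈ els H → map (t ∘ₚ_) (els H) ↭ els H
translate-↭ H {t} t∈H with inv∈ H t∈H
... | w , w∈H , tw≡id , wt≡id =
  ∼bag⇒↭ (unique∧set⇒bag (Unique.map⁺ injective (unique H)) (unique H) (mk⇔ to from))
  where
  injective : ∀ {u v} → t ∘ₚ u ≡ t ∘ₚ v → u ≡ v
  injective {u} {v} tu≡tv =
    trans (sym (∘ₚ-cancelˡ w t wt≡id u)) (trans (cong (w ∘ₚ_) tu≡tv) (∘ₚ-cancelˡ w t wt≡id v))
  to : ∀ {u} → u ∈ map (t ∘ₚ_) (els H) → u ∈ els H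
  to u∈tH with ∈-map⁻ (t ∘ₚ_) u∈tH
  ... | h , h∈H , refl = comp∈ H t∈H h∈H
  from : ∀ {u} → u ∈ els H → u ∈ map (t ∘ₚ_) (els H)
  from {u} u∈H =
    subst (_∈ map (t ∘ₚ_) (els H)) (∘ₚ-cancelˡ t w tw≡id u) (∈-map⁺ (t ∘ₚ_) (comp∈ H w∈H u∈H))

∑-translate : (H : PermGroup n) {t : Perm n} → t ∈ els H → (f : Perm n → ℕ) →
  ∑[ h ∈ els H ] f (t ∘ₚ h) ≡ ∑ (els H) f
∑-translate H {t} t∈H f = trans (sym (∑-map (t ∘ₚ_) (els H) f)) (∑-↭ f (translate-↭ H t∈H))

#mapping : PermGroup n → Fin n → Fin n → ℕ
#mapping H b y = ∑[ h ∈ els H ] 𝟙 (lookup h b ≟ y)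

#mapping-transitive : (H : PermGroup n) → Transitive H → (b y : Fin n) →
  #mapping H b y ≡ #mapping H b b
#mapping-transitive H transitive b y with transitive b y
... | t , t∈H , tb≡y with inv∈ H t∈H
... | w , _ , _ , wt≡id = begin
  #mapping H b y                             ≡⟨ ∑-translate H t∈H _ ⟨
  ∑[ h ∈ els H ] 𝟙 (lookup (t ∘ₚ h) b ≟ y)  ≡⟨ ∑-cong (els H) (λ h → 𝟙-⇔ _ _ (mk⇔ (to h) (from h))) ⟩
  #mapping H b b                             ∎
  where
  to : ∀ h → lookup (t ∘ₚ h) b ≡ y → lookup h b ≡ b
  to h thb≡y =
    lookup-injective w t wt≡id (trans (sym (lookup-∘ₚ t h b)) (trans thb≡y (sym tb≡y)))
  from : ∀ h → lookup h b ≡ b → lookup (t ∘ₚ h) b ≡ y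
  from h hb≡b = trans (lookup-∘ₚ t h b) (trans (cong (lookup t) hb≡b) tb≡y)

∑-#mapping : (H : PermGroup n) (b : Fin n) → ∑[ y ∈ allFin n ] #mapping H b y ≡ # H
∑-#mapping {n} H b = begin
  ∑[ y ∈ allFin n ] #mapping H b y
    ≡⟨ ∑-comm (allFin n) (els H) _ ⟩
  ∑[ h ∈ els H ] ∑[ y ∈ allFin n ] 𝟙 (lookup h b ≟ y)
    ≡⟨ ∑-cong (els H) (λ h → ∑-𝟙-≟ _≟_ (Unique.allFin⁺ n) (∈-allFin (lookup h b))) ⟩
  ∑ (els H) (λ _ → 1)
    ≡⟨ length≡∑1 (els H) ⟨
  # H
    ∎

orbit-stabiliser : (H : PermGroup n) → Transitive H → (b : Fin n) → n * #mapping H b b ≡ # H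
orbit-stabiliser {n} H transitive b = begin
  n * #mapping H b b                    ≡⟨ cong (_* #mapping H b b) (length-tabulate {n = n} id) ⟨
  length (allFin n) * #mapping H b b    ≡⟨ ∑-const (allFin n) _ ⟨
  ∑ (allFin n) (λ _ → #mapping H b b)   ≡⟨ ∑-cong (allFin n) (#mapping-transitive H transitive b) ⟨
  ∑[ y ∈ allFin n ] #mapping H b y      ≡⟨ ∑-#mapping H b ⟩
  # H                                   ∎

∑-#Fix-transitive : (H : PermGroup (suc n)) → Transitive H → ∑ (els H) #Fix ≡ # H
∑-#Fix-transitive {n} H transitive = *-cancelˡ-≡ _ _ (suc n) (begin
  suc n * ∑ (els H) #Fix
    ≡⟨ cong (suc n *_) (∑-cong (els H) #Fix≡∑𝟙) ⟩
  suc n * ∑[ h ∈ els H ] ∑[ b ∈ allFin (suc n) ] 𝟙 (lookup h b ≟ b)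
    ≡⟨ cong (suc n *_) (∑-comm (els H) (allFin (suc n)) _) ⟩
  suc n * ∑[ b ∈ allFin (suc n) ] #mapping H b b
    ≡⟨ ∑-*ˡ (allFin (suc n)) (suc n) _ ⟨
  ∑[ b ∈ allFin (suc n) ] (suc n * #mapping H b b)
    ≡⟨ ∑-cong (allFin (suc n)) (orbit-stabiliser H transitive) ⟩
  ∑ (allFin (suc n)) (λ _ → # H)
    ≡⟨ ∑-const (allFin (suc n)) _ ⟩
  length (allFin (suc n)) * # H
    ≡⟨ cong (_* # H) (length-tabulate {n = suc n} id) ⟩
  suc n * # H
    ∎)

#wreath-Fin0 : (G : PermGroup m) (H : PermGroup 0) → #wreath G H ≡ # G
#wreath-Fin0 {m} G H = begin
  #wreath G H
    ≡⟨ length-cartesianProduct (els G) (allVecs m (els H)) ⟩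
  # G * length (allVecs m (els H))
    ≡⟨ cong (# G *_) (length-allVecs m (els H)) ⟩
  # G * # H ^ m
    ≡⟨ cong (λ k → # G * k ^ m) (length-Unique-Irrelevant Perm0-irrelevant (unique H) (id∈ H)) ⟩
  # G * 1 ^ m
    ≡⟨ cong (# G *_) (^-zeroˡ m) ⟩
  # G * 1
    ≡⟨ *-identityʳ (# G) ⟩
  # G
    ∎
  where
  Perm0-irrelevant : Irrelevant (Perm 0)
  Perm0-irrelevant [] [] = refl

lemma3p6 : ∀ {m n} (G : PermGroup m) (H : PermGroup n) →
    Transitive G → Primitive H →
    AFPLP G H ⊎ #wreath G H ≡ # G
lemma3p6 {n = zero}  G H _ _ = inj₂ (#wreath-Fin0 G H)
lemma3p6 {n = suc _} G H _ (H-transitive , _) =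
  inj₁ (∑#Fix≡#⇒AFPLP G H (∑-#Fix-transitive H H-transitive))
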